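{- Let $k$ be a positive integer. If a graph $G$ contains a substructure $S\in\mathcal{S}_k$, then $\gamma_{\rm SMB}'(G)\le k$.
   Context: The Maker-Breaker domination game on a finite simple graph $G$: Dominator and Staller alternately claim previously unclaimed vertices of $G$. Staller wins if she claims all vertices of the closed neighborhood $N_G[v]$ of some vertex $v$; otherwise Dominator wins. In the S-game Staller moves first. $\gamma_{\rm SMB}'(G)$ is the minimum number of moves Staller needs to win the S-game under optimal play (Staller minimizing the number of her moves, Dominator trying to prevent or delay her win), $\infty$ if Staller has no winning strategy. Families $\mathcal{S}_k$ of graphs, each $S\in\mathcal{S}_k$ with a vertex subset $X(S)$, are defined recursively: $\mathcal{S}_1=\{P_1\}$ with $X(P_1)=V(P_1)$. For $k\ge2$, $\mathcal{S}_k^*$ consists of graphs obtained by taking vertex-disjoint $S^1\in\mathcal{S}_{k-1}$ and $S^2\in\bigcup_{i=1}^{k-1}\mathcal{S}_i$, a new vertex $z_k$, choosing $x^j\in X(S^j)$ for $j=1,2$, and joining $z_k$ to $x^1$ and $x^2$; then $X(S)=X(S^1)\cup X(S^2)$. Set $\mathcal{S}_k=\mathcal{S}_k^*\setminus\bigcup_{i=1}^{k-1}\mathcal{S}_i$. A graph $S\in\bigcup_k\mathcal{S}_k$ is a substructure in $G$ if $S$ is (isomorphic to) a subgraph of $G$ and $\deg_G(x)=\deg_S(x)$ for every $x\in X(S)$. -}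

module Defs where

open import Data.Nat using (ℕ; zero; suc; _+_; _≤_; _<_)
open import Data.Bool using (Bool; true; false)
open import Data.Fin using (Fin; zero; suc; splitAt; _≟_)
open import Data.Fin.Subset using (Subset; _∈_; _∉_; _∪_; ⁅_⁆; ∣_∣)
  renaming (⊥ to ∅)
open import Data.Vec using (tabulate)
open import Data.Sum using (_⊎_; inj₁; inj₂)
open import Data.Product using (Σ; ∃; ∃-syntax; _×_; _,_)
open import Data.Unit using (⊤; tt)
open import Data.Empty using (⊥)
open import Relation.Nullary using (¬_; ⌊_⌋)
open import Relation.Binary.PropositionalEquality using (_≡_)
open import Function.Bundles using (_↔_; Inverse)
open import Function.Definitions using (Injective)

record Graph : Set where
  field
    n     : ℕ
    adj   : Fin n → Fin n → Bool
    sym   : ∀ u v → adj u v ≡ adj v u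
    irref : ∀ v → adj v v ≡ false
open Graph public

degree : ∀ {m} → (Fin m → Fin m → Bool) → Fin m → ℕ
degree adj' v = ∣ tabulate (adj' v) ∣

-- Maker-Breaker domination game, S-game.
-- A position is (D, S): vertices claimed by Dominator / Staller.

module _ (G : Graph) where
  private
    V = Fin (n G)

  OwnsClosedNbhd : Subset (n G) → Set
  OwnsClosedNbhd T = ∃[ w ] (∀ (x : V) → (x ≡ w ⊎ adj G w x ≡ true) → x ∈ T)

  Free : Subset (n G) → Subset (n G) → V → Set
  Free D S v = v ∉ D × v ∉ S

  -- After Staller's move, if she has not won,
  -- Dominator must claim a free vertex; if none is left the game is over
  -- and Dominator has won.
  StallerWinsWithin : ℕ → Subset (n G) → Subset (n G) → Set
  StallerWinsWithin zero    D S = ⊥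
  StallerWinsWithin (suc k) D S =
    ∃[ v ] (Free D S v ×
      (OwnsClosedNbhd (S ∪ ⁅ v ⁆)
       ⊎ ((∃[ u ] Free D (S ∪ ⁅ v ⁆) u)
          × (∀ u → Free D (S ∪ ⁅ v ⁆) u →
               StallerWinsWithin k (D ∪ ⁅ u ⁆) (S ∪ ⁅ v ⁆)))))

γ'SMB≤ : Graph → ℕ → Set
γ'SMB≤ G k = StallerWinsWithin G k ∅ ∅

record MGraph : Set where
  field
    size : ℕ
    madj : Fin size → Fin size → Bool
    X    : Subset size
open MGraph public

P₁ : MGraph
P₁ = record { size = 1 ; madj = λ _ _ → false ; X = ⁅ zero ⁆ }

_≅_ : MGraph → MGraph → Set
A ≅ B = Σ (Fin (size A) ↔ Fin (size B)) λ f →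
  (∀ a b → madj B (Inverse.to f a) (Inverse.to f b) ≡ madj A a b)
  × (∀ a → (a ∈ X A → Inverse.to f a ∈ X B) × (Inverse.to f a ∈ X B → a ∈ X A))

-- The gluing construction: disjoint union of S¹, S² plus a new vertex z
-- (vertex zero) joined to x¹ ∈ V(S¹) and x² ∈ V(S²); X = X(S¹) ∪ X(S²).
module Glue (S¹ S² : MGraph) (x¹ : Fin (size S¹)) (x² : Fin (size S²)) where
  m₁ = size S¹
  m₂ = size S²
  W = Fin (suc (m₁ + m₂))

  view : W → ⊤ ⊎ (Fin m₁ ⊎ Fin m₂)
  view zero    = inj₁ tt
  view (suc i) = inj₂ (splitAt m₁ i)

  adjV : ⊤ ⊎ (Fin m₁ ⊎ Fin m₂) → ⊤ ⊎ (Fin m₁ ⊎ Fin m₂) → Bool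
  adjV (inj₁ _)        (inj₁ _)        = false
  adjV (inj₁ _)        (inj₂ (inj₁ a)) = ⌊ a ≟ x¹ ⌋
  adjV (inj₁ _)        (inj₂ (inj₂ b)) = ⌊ b ≟ x² ⌋
  adjV (inj₂ (inj₁ a)) (inj₁ _)        = ⌊ a ≟ x¹ ⌋
  adjV (inj₂ (inj₂ b)) (inj₁ _)        = ⌊ b ≟ x² ⌋
  adjV (inj₂ (inj₁ a)) (inj₂ (inj₁ b)) = madj S¹ a b
  adjV (inj₂ (inj₂ a)) (inj₂ (inj₂ b)) = madj S² a b
  adjV (inj₂ (inj₁ _)) (inj₂ (inj₂ _)) = false
  adjV (inj₂ (inj₂ _)) (inj₂ (inj₁ _)) = false

  inXV : ⊤ ⊎ (Fin m₁ ⊎ Fin m₂) → Bool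
  inXV (inj₁ _)        = false
  inXV (inj₂ (inj₁ a)) = Data.Vec.lookup (X S¹) a
  inXV (inj₂ (inj₂ b)) = Data.Vec.lookup (X S²) b

  glued : MGraph
  glued = record
    { size = suc (m₁ + m₂)
    ; madj = λ u v → adjV (view u) (view v)
    ; X    = tabulate (λ u → inXV (view u))
    }

open Glue using (glued) public

mutual
  InS : ℕ → MGraph → Set
  InS zero                S = ⊥
  InS (suc zero)          S = S ≅ P₁
  InS (suc (suc k))       S = Star (suc k) S × ¬ InUpTo (suc k) S

  Star : ℕ → MGraph → Set
  Star k S = ∃[ S¹ ] ∃[ S² ] ∃[ x¹ ] ∃[ x² ]
    (InS k S¹ × InUpTo k S² × x¹ ∈ X S¹ × x² ∈ X S²
      × S ≅ glued S¹ S² x¹ x²)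

  InUpTo : ℕ → MGraph → Set
  InUpTo zero    S = ⊥
  InUpTo (suc k) S = InUpTo k S ⊎ InS (suc k) S

Substructure : MGraph → Graph → Set
Substructure S G = Σ (Fin (size S) → Fin (n G)) λ f →
  Injective _≡_ _≡_ f
  × (∀ a b → madj S a b ≡ true → adj G (f a) (f b) ≡ true)
  × (∀ x → x ∈ X S → degree (adj G) (f x) ≡ degree (madj S) x)

{-# OPTIONS --safe #-}
-- Staller maintains a free copy of a member of some 𝒮ⱼ: an embedded copy on
-- unclaimed vertices in which every G-neighbour of (the image of) an
-- X-vertex is either the image of one of its neighbours in the copy or
-- already hers.  The degree condition of a substructure is exactly what
-- makes this hold on the empty board.  In a copy of a glued graph she claims
-- z; its two branches are disjoint, so Dominator's reply meets at most one of
-- them, and the other is a free copy one level lower, z now being hers (if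
-- no vertex is left for Dominator, every vertex of N[x¹] is already hers).
-- A free copy of P₁ is won by claiming its vertex.
module Submission where

open import Defs
open import Data.Nat using (ℕ; _≤_)
open import Data.Product using (∃-syntax; _×_)

open import Data.Nat using (zero; suc; _+_; _<_; z≤n; s≤s)
open import Data.Nat.Properties using (≤-trans; <-irrefl)
open import Data.Product using (_,_; proj₂)
open import Data.Sum using (_⊎_; inj₁; inj₂)
open import Data.Bool using (Bool; true; false)
import Data.Bool as Bool
open import Data.Fin using (Fin; zero; suc; splitAt; _↑ˡ_; _↑ʳ_)
import Data.Fin as Fin
open import Data.Fin.Properties
  using (any?; 0≢1+n; splitAt-↑ˡ; splitAt-↑ʳ; splitAt⁻¹-↑ˡ; splitAt⁻¹-↑ʳ; ↑ˡ-injective; ↑ʳ-injective; suc-injective)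
open import Data.Fin.Subset using (Subset; _∈_; _∉_; _∪_; ⁅_⁆; ∣_∣; _-_) renaming (⊥ to ∅)
open import Data.Fin.Subset.Properties
  using (x∈p∪q⁻; x∈p∪q⁺; x∈⁅x⁆; x∈⁅y⁆⇒x≡y; _∈?_; x∈p⇒∣p-x∣<∣p∣; x∈p∧x≢y⇒x∈p-y; ∉⊥)
open import Data.Vec using ([]; _∷_; tabulate; here; there)
open import Data.Vec.Properties using (lookup∘tabulate; []=⇒lookup; lookup⇒[]=)
open import Data.Empty using (⊥-elim)
open import Relation.Nullary using (¬_; yes; no; Dec)
open import Relation.Nullary.Decidable using (_×-dec_; ¬?)
open import Relation.Binary.PropositionalEquality
  using (_≡_; _≢_; refl; trans; cong; cong₂; subst)
  renaming (sym to ≡-sym)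
open import Function using (_∘_)
open import Function.Bundles using (Inverse)
open import Function.Definitions using (Injective)

∈-tabulate⁺ : ∀ {m} (g : Fin m → Bool) b → g b ≡ true → b ∈ tabulate g
∈-tabulate⁺ g b gb = lookup⇒[]= b _ (trans (lookup∘tabulate g b) gb)

∈-tabulate⁻ : ∀ {m} (g : Fin m → Bool) b → b ∈ tabulate g → g b ≡ true
∈-tabulate⁻ g b b∈ = trans (≡-sym (lookup∘tabulate g b)) ([]=⇒lookup b∈)

∉-∪-⁅⁆ : ∀ {m} {x u : Fin m} {p : Subset m} → x ∉ p → x ≢ u → x ∉ p ∪ ⁅ u ⁆
∉-∪-⁅⁆ {u = u} {p} x∉p x≢u x∈ with x∈p∪q⁻ p ⁅ u ⁆ x∈
... | inj₁ x∈p = x∉p x∈p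
... | inj₂ x∈u = x≢u (x∈⁅y⁆⇒x≡y u x∈u)

↑ˡ⊎↑ʳ : ∀ m₁ m₂ (i : Fin (m₁ + m₂)) → (∃[ a ] i ≡ a ↑ˡ m₂) ⊎ (∃[ b ] i ≡ m₁ ↑ʳ b)
↑ˡ⊎↑ʳ m₁ m₂ i with splitAt m₁ i in eq
... | inj₁ a = inj₁ (a , ≡-sym (splitAt⁻¹-↑ˡ eq))
... | inj₂ b = inj₂ (b , ≡-sym (splitAt⁻¹-↑ʳ eq))

injection-missing⇒∣p∣<∣q∣ : ∀ {m k} (f : Fin m → Fin k) → Injective _≡_ _≡_ f →
  (p : Subset m) (q : Subset k) → (∀ a → a ∈ p → f a ∈ q) →
  ∀ y → y ∈ q → (∀ a → a ∈ p → f a ≢ y) → ∣ p ∣ < ∣ q ∣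
injection-missing⇒∣p∣<∣q∣ f f-inj [] q p⊆q y y∈q _ = ≤-trans (s≤s z≤n) (x∈p⇒∣p-x∣<∣p∣ y∈q)
injection-missing⇒∣p∣<∣q∣ f f-inj (false ∷ p) q p⊆q y y∈q f≢y =
  injection-missing⇒∣p∣<∣q∣ (f ∘ suc) (suc-injective ∘ f-inj) p q
    (λ a → p⊆q (suc a) ∘ there) y y∈q (λ a → f≢y (suc a) ∘ there)
injection-missing⇒∣p∣<∣q∣ f f-inj (true ∷ p) q p⊆q y y∈q f≢y =
  ≤-trans (s≤s (injection-missing⇒∣p∣<∣q∣ (f ∘ suc) (suc-injective ∘ f-inj) p (q - f zero)
                  p⊆q-f₀ y (x∈p∧x≢y⇒x∈p-y y∈q (f≢y zero here ∘ ≡-sym)) (λ a → f≢y (suc a) ∘ there)))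
          (x∈p⇒∣p-x∣<∣p∣ (p⊆q zero here))
  where
  p⊆q-f₀ : ∀ a → a ∈ p → f (suc a) ∈ q - f zero
  p⊆q-f₀ a a∈p = x∈p∧x≢y⇒x∈p-y (p⊆q (suc a) (there a∈p)) (0≢1+n ∘ ≡-sym ∘ f-inj)

record FreeCopy (G : Graph) (S : MGraph) (D T : Subset (n G)) : Set where
  field
    emb           : Fin (size S) → Fin (n G)
    emb-injective : Injective _≡_ _≡_ emb
    X-neighbour   : ∀ x → x ∈ X S → ∀ y → adj G (emb x) y ≡ true →
                    (∃[ b ] (madj S x b ≡ true × emb b ≡ y)) ⊎ y ∈ T
    emb∉D         : ∀ a → emb a ∉ D
    emb∉T         : ∀ a → emb a ∉ T
open FreeCopy

record Branch (R S : MGraph) (z : Fin (size S)) : Set where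
  field
    ι           : Fin (size R) → Fin (size S)
    ι-injective : Injective _≡_ _≡_ ι
    ι-X         : ∀ x → x ∈ X R → ι x ∈ X S
    ι-neighbour : ∀ x c → madj S (ι x) c ≡ true →
                  (∃[ b ] (madj R x b ≡ true × ι b ≡ c)) ⊎ c ≡ z
    ι≢z         : ∀ a → ι a ≢ z
open Branch

module GluedBranches (S¹ S² : MGraph) (x¹ : Fin (size S¹)) (x² : Fin (size S²)) where
  open Glue S¹ S² x¹ x² using (m₁; m₂; view; adjV; inXV)

  e₁ : Fin m₁ → Fin (size (glued S¹ S² x¹ x²))
  e₁ a = suc (a ↑ˡ m₂)

  e₂ : Fin m₂ → Fin (size (glued S¹ S² x¹ x²))
  e₂ b = suc (m₁ ↑ʳ b)

  view-e₁ : ∀ a → view (e₁ a) ≡ inj₂ (inj₁ a)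
  view-e₁ a = cong inj₂ (splitAt-↑ˡ m₁ a m₂)

  view-e₂ : ∀ b → view (e₂ b) ≡ inj₂ (inj₂ b)
  view-e₂ b = cong inj₂ (splitAt-↑ʳ m₁ m₂ b)

  e₁≢e₂ : ∀ a b → e₁ a ≢ e₂ b
  e₁≢e₂ a b eq with trans (≡-sym (view-e₁ a)) (trans (cong view eq) (view-e₂ b))
  ... | ()

  branch₁ : Branch S¹ (glued S¹ S² x¹ x²) zero
  branch₁ = record
    { ι           = e₁
    ; ι-injective = ↑ˡ-injective m₂ _ _ ∘ suc-injective
    ; ι-X         = λ a a∈X → ∈-tabulate⁺ (inXV ∘ view) (e₁ a)
                      (trans (cong inXV (view-e₁ a)) ([]=⇒lookup a∈X))
    ; ι-neighbour = ι-neighbour′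
    ; ι≢z         = λ _ ()
    }
    where
    ι-neighbour′ : ∀ x c → adjV (view (e₁ x)) (view c) ≡ true →
      (∃[ b ] (madj S¹ x b ≡ true × e₁ b ≡ c)) ⊎ c ≡ zero
    ι-neighbour′ x zero    _ = inj₂ refl
    ι-neighbour′ x (suc i) x~c with ↑ˡ⊎↑ʳ m₁ m₂ i
    ... | inj₁ (b , refl) = inj₁ (b , trans (≡-sym (cong₂ adjV (view-e₁ x) (view-e₁ b))) x~c , refl)
    ... | inj₂ (b , refl) with trans (≡-sym (cong₂ adjV (view-e₁ x) (view-e₂ b))) x~c
    ...   | ()

  branch₂ : Branch S² (glued S¹ S² x¹ x²) zero
  branch₂ = record
    { ι           = e₂
    ; ι-injective = ↑ʳ-injective m₁ _ _ ∘ suc-injective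
    ; ι-X         = λ b b∈X → ∈-tabulate⁺ (inXV ∘ view) (e₂ b)
                      (trans (cong inXV (view-e₂ b)) ([]=⇒lookup b∈X))
    ; ι-neighbour = ι-neighbour′
    ; ι≢z         = λ _ ()
    }
    where
    ι-neighbour′ : ∀ x c → adjV (view (e₂ x)) (view c) ≡ true →
      (∃[ b ] (madj S² x b ≡ true × e₂ b ≡ c)) ⊎ c ≡ zero
    ι-neighbour′ x zero    _ = inj₂ refl
    ι-neighbour′ x (suc i) x~c with ↑ˡ⊎↑ʳ m₁ m₂ i
    ... | inj₂ (b , refl) = inj₁ (b , trans (≡-sym (cong₂ adjV (view-e₂ x) (view-e₂ b))) x~c , refl)
    ... | inj₁ (b , refl) with trans (≡-sym (cong₂ adjV (view-e₂ x) (view-e₁ b))) x~c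
    ...   | ()

module _ (G : Graph) where

  degree-preserved⇒neighbour-in-image : ∀ S (f : Fin (size S) → Fin (n G)) →
    Injective _≡_ _≡_ f → (∀ a b → madj S a b ≡ true → adj G (f a) (f b) ≡ true) →
    ∀ x → degree (adj G) (f x) ≡ degree (madj S) x →
    ∀ y → adj G (f x) y ≡ true → ∃[ b ] (madj S x b ≡ true × f b ≡ y)
  degree-preserved⇒neighbour-in-image S f f-inj f-edge x deg y fx~y
    with any? (λ b → (madj S x b Bool.≟ true) ×-dec (f b Fin.≟ y))
  ... | yes found = found
  ... | no none = ⊥-elim (<-irrefl (≡-sym deg) (injection-missing⇒∣p∣<∣q∣ f f-inj
          (tabulate (madj S x)) (tabulate (adj G (f x)))
          (λ b b∈ → ∈-tabulate⁺ _ (f b) (f-edge x b (∈-tabulate⁻ _ b b∈)))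
          y (∈-tabulate⁺ _ y fx~y)
          (λ b b∈ fb≡y → none (b , ∈-tabulate⁻ _ b b∈ , fb≡y))))

  Substructure⇒FreeCopy : ∀ {S} → Substructure S G → FreeCopy G S ∅ ∅
  Substructure⇒FreeCopy {S} (f , f-inj , f-edge , f-deg) = record
    { emb           = f
    ; emb-injective = f-inj
    ; X-neighbour   = λ x x∈X y fx~y →
        inj₁ (degree-preserved⇒neighbour-in-image S f f-inj f-edge x (f-deg x x∈X) y fx~y)
    ; emb∉D         = λ _ → ∉⊥
    ; emb∉T         = λ _ → ∉⊥
    }

  FreeCopy-≅ : ∀ {S S′ D T} → S ≅ S′ → FreeCopy G S D T → FreeCopy G S′ D T
  FreeCopy-≅ {S′ = S′} {T = T} (φ , φ-adj , φ-X) C = record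
    { emb           = emb C ∘ from
    ; emb-injective = λ {a} {b} eq →
        trans (≡-sym (to∘from a)) (trans (cong to (emb-injective C eq)) (to∘from b))
    ; X-neighbour   = X-neighbour′
    ; emb∉D         = emb∉D C ∘ from
    ; emb∉T         = emb∉T C ∘ from
    }
    where
    open Inverse φ using (to; from) renaming (strictlyInverseˡ to to∘from; strictlyInverseʳ to from∘to)
    X-neighbour′ : ∀ x → x ∈ X S′ → ∀ y → adj G (emb C (from x)) y ≡ true →
      (∃[ b ] (madj S′ x b ≡ true × emb C (from b) ≡ y)) ⊎ y ∈ T
    X-neighbour′ x x∈X y ~y
      with X-neighbour C (from x) (proj₂ (φ-X (from x)) (subst (_∈ X S′) (≡-sym (to∘from x)) x∈X)) y ~y
    ... | inj₂ y∈T = inj₂ y∈T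
    ... | inj₁ (c , x~c , fc≡y) = inj₁ (to c ,
          trans (cong (λ w → madj S′ w (to c)) (≡-sym (to∘from x))) (trans (φ-adj (from x) c) x~c) ,
          trans (cong (emb C) (from∘to c)) fc≡y)

  FreeCopy-branch : ∀ {R S z D T} (B : Branch R S z) (C : FreeCopy G S D T) →
    ∀ D′ → (∀ a → emb C (ι B a) ∉ D′) → FreeCopy G R D′ (T ∪ ⁅ emb C z ⁆)
  FreeCopy-branch {R = R} {z = z} {T = T} B C D′ ι∉D′ = record
    { emb           = emb C ∘ ι B
    ; emb-injective = ι-injective B ∘ emb-injective C
    ; X-neighbour   = X-neighbour′
    ; emb∉D         = ι∉D′
    ; emb∉T         = λ a → ∉-∪-⁅⁆ (emb∉T C (ι B a)) (ι≢z B a ∘ emb-injective C)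
    }
    where
    X-neighbour′ : ∀ x → x ∈ X R → ∀ y → adj G (emb C (ι B x)) y ≡ true →
      (∃[ b ] (madj R x b ≡ true × emb C (ι B b) ≡ y)) ⊎ y ∈ T ∪ ⁅ emb C z ⁆
    X-neighbour′ x x∈X y ~y with X-neighbour C (ι B x) (ι-X B x x∈X) y ~y
    ... | inj₂ y∈T = inj₂ (x∈p∪q⁺ (inj₁ y∈T))
    ... | inj₁ (c , ιx~c , refl) with ι-neighbour B x c ιx~c
    ...   | inj₁ (b , x~b , refl) = inj₁ (b , x~b , refl)
    ...   | inj₂ refl = inj₂ (x∈p∪q⁺ (inj₂ (x∈⁅x⁆ _)))

  StallerWinsWithin-suc : ∀ k {D T} → StallerWinsWithin G k D T → StallerWinsWithin G (suc k) D T
  StallerWinsWithin-suc (suc k) (v , v-free , inj₁ owns) = v , v-free , inj₁ owns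
  StallerWinsWithin-suc (suc k) (v , v-free , inj₂ (u-free , wins)) =
    v , v-free , inj₂ (u-free , λ u fu → StallerWinsWithin-suc k (wins u fu))

  full-board⇒OwnsClosedNbhd : ∀ {S D T} → FreeCopy G S D T → ∀ x → x ∈ X S →
    ¬ (∃[ u ] Free G D T u) → OwnsClosedNbhd G T
  full-board⇒OwnsClosedNbhd {D = D} {T = T} C x x∈X full = emb C x , N[x]⊆T
    where
    ∉D⇒∈T : ∀ y → y ∉ D → y ∈ T
    ∉D⇒∈T y y∉D with y ∈? T
    ... | yes y∈T = y∈T
    ... | no y∉T = ⊥-elim (full (y , y∉D , y∉T))
    N[x]⊆T : ∀ y → y ≡ emb C x ⊎ adj G (emb C x) y ≡ true → y ∈ T
    N[x]⊆T y (inj₁ refl) = ∉D⇒∈T y (emb∉D C x)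
    N[x]⊆T y (inj₂ x~y) with X-neighbour C x x∈X y x~y
    ... | inj₂ y∈T = y∈T
    ... | inj₁ (b , _ , refl) = ∉D⇒∈T (emb C b) (emb∉D C b)

  FreeCopy-P₁⇒wins : ∀ {D T} → FreeCopy G P₁ D T → StallerWinsWithin G 1 D T
  FreeCopy-P₁⇒wins {T = T} C = v , (emb∉D C zero , emb∉T C zero) , inj₁ (v , N[v]⊆T∪v)
    where
    v = emb C zero
    N[v]⊆T∪v : ∀ y → y ≡ v ⊎ adj G v y ≡ true → y ∈ T ∪ ⁅ v ⁆
    N[v]⊆T∪v y (inj₁ refl) = x∈p∪q⁺ (inj₂ (x∈⁅x⁆ v))
    N[v]⊆T∪v y (inj₂ v~y) with X-neighbour C zero here y v~y
    ... | inj₂ y∈T = x∈p∪q⁺ (inj₁ y∈T)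
    ... | inj₁ (_ , () , _)

  FreeCopy-fork⇒wins : ∀ {S R₁ R₂ z D T} k (B₁ : Branch R₁ S z) (B₂ : Branch R₂ S z) →
    (∀ a b → ι B₁ a ≢ ι B₂ b) → ∃[ x ] x ∈ X R₁ → FreeCopy G S D T →
    (∀ {D′ T′} → FreeCopy G R₁ D′ T′ → StallerWinsWithin G (suc k) D′ T′) →
    (∀ {D′ T′} → FreeCopy G R₂ D′ T′ → StallerWinsWithin G (suc k) D′ T′) →
    StallerWinsWithin G (suc (suc k)) D T
  FreeCopy-fork⇒wins {z = z} {D} {T} k B₁ B₂ disjoint (x , x∈X) C wins₁ wins₂ =
    v , (emb∉D C z , emb∉T C z) , after-v (any? (λ u → ¬? (u ∈? D) ×-dec ¬? (u ∈? T′)))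
    where
    v = emb C z
    T′ = T ∪ ⁅ v ⁆
    reply : ∀ u → Free G D T′ u → StallerWinsWithin G (suc k) (D ∪ ⁅ u ⁆) T′
    reply u _ with any? (λ a → emb C (ι B₁ a) Fin.≟ u)
    ... | yes (a , hits₁) = wins₂ (FreeCopy-branch B₂ C (D ∪ ⁅ u ⁆) (λ b →
          ∉-∪-⁅⁆ (emb∉D C (ι B₂ b)) (λ eq → disjoint a b (emb-injective C (trans hits₁ (≡-sym eq))))))
    ... | no misses₁ = wins₁ (FreeCopy-branch B₁ C (D ∪ ⁅ u ⁆) (λ a →
          ∉-∪-⁅⁆ (emb∉D C (ι B₁ a)) (λ eq → misses₁ (a , eq))))
    after-v : Dec (∃[ u ] Free G D T′ u) → OwnsClosedNbhd G T′ ⊎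
      ((∃[ u ] Free G D T′ u) × (∀ u → Free G D T′ u → StallerWinsWithin G (suc k) (D ∪ ⁅ u ⁆) T′))
    after-v (yes some) = inj₂ (some , reply)
    after-v (no full)  =
      inj₁ (full-board⇒OwnsClosedNbhd (FreeCopy-branch B₁ C D (emb∉D C ∘ ι B₁)) x x∈X full)

  mutual
    InS-FreeCopy⇒wins : ∀ k S → InS k S → ∀ {D T} → FreeCopy G S D T → StallerWinsWithin G k D T
    InS-FreeCopy⇒wins (suc zero) S S≅P₁ C = FreeCopy-P₁⇒wins (FreeCopy-≅ S≅P₁ C)
    InS-FreeCopy⇒wins (suc (suc k)) S ((S¹ , S² , x¹ , x² , S¹∈ , S²∈ , x¹∈X , _ , S≅) , _) C =
      FreeCopy-fork⇒wins k branch₁ branch₂ e₁≢e₂ (x¹ , x¹∈X) (FreeCopy-≅ S≅ C)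
        (InS-FreeCopy⇒wins (suc k) S¹ S¹∈) (InUpTo-FreeCopy⇒wins (suc k) S² S²∈)
      where open GluedBranches S¹ S² x¹ x²

    InUpTo-FreeCopy⇒wins : ∀ k S → InUpTo k S → ∀ {D T} → FreeCopy G S D T → StallerWinsWithin G k D T
    InUpTo-FreeCopy⇒wins (suc k) S (inj₁ S∈≤k) C = StallerWinsWithin-suc k (InUpTo-FreeCopy⇒wins k S S∈≤k C)
    InUpTo-FreeCopy⇒wins (suc k) S (inj₂ S∈k)   C = InS-FreeCopy⇒wins (suc k) S S∈k C

corollary16 : (k : ℕ) → 1 ≤ k → (G : Graph) →
    (∃[ S ] (InS k S × Substructure S G)) → γ'SMB≤ G k
corollary16 k _ G (S , S∈𝒮ₖ , S⊆G) = InS-FreeCopy⇒wins G k S S∈𝒮ₖ (Substructure⇒FreeCopy G S⊆G)
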